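{- For every benign 12-SV table $T$ of shape $\lambda/\mu$ there exists a unique $N\in\mathrm{SVRPP}^{12}(\lambda/\mu)$ such that $T\xrightarrow{*}N$.
   Context: Boxes are $(i,j)$ (row $i$, column $j$); $\lambda/\mu$ is a skew diagram. A 12-SV table is a filling of $\lambda/\mu$ by nonempty subsets of $\{1,2\}$ weakly increasing down each column (max of a box $\le$ min of the box below). $\mathrm{SVRPP}^{12}(\lambda/\mu)$ is the set of 12-SV tables whose sets also weakly increase along rows (equivalently, 12-SV tables with no descent). A nonempty column is 1-pure if all its sets are $\{1\}$, 2-pure if all are $\{2\}$, mixed otherwise. For a mixed column $k$, $\mathrm{sep}_k(T)$ is the smallest row $r$ with $2\in T(r,k)$. If the mixed columns are $k_1<\cdots<k_p$, $T$ is benign if $\mathrm{sep}_{k_1}\ge\cdots\ge\mathrm{sep}_{k_p}$ and $\mathrm{sep}_{k_j}>\mathrm{sep}_{k_{j+1}}$ whenever column $k_{j+1}$ contains a box equal to $\{1,2\}$. A column index $k$ is a descent of $T$ if some row $i$ has $(i,k),(i,k+1)\in\lambda/\mu$, $\max T(i,k)=2$, $\min T(i,k+1)=1$. For benign $T$ with descent $k$, $\mathrm{res}_k(T)$ changes only columns $k,k+1$: (M1) column $k$ mixed, column $k+1$ 1-pure, $r=\mathrm{sep}_k(T)$: column $k$ becomes all $\{1\}$; in column $k+1$ rows $<r$ get $\{1\}$, row $r$ gets $T(r,k)$, rows $>r$ get $\{2\}$. (2M) column $k$ 2-pure, column $k+1$ mixed, $s$ the largest row with $1\in T(s,k+1)$: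 column $k+1$ becomes all $\{2\}$; in column $k$ rows $<s$ get $\{1\}$, row $s$ gets $T(s,k+1)$, rows $>s$ get $\{2\}$. (21) column $k$ 2-pure, column $k+1$ 1-pure: column $k$ becomes all $\{1\}$, column $k+1$ all $\{2\}$. (For benign $T$ these are the only cases, and $\mathrm{res}_k(T)$ is again benign.) Write $P\to Q$ if $Q=\mathrm{res}_k(P)$ for some descent $k$ of $P$; $\xrightarrow{*}$ is the reflexive–transitive closure of $\to$. -}

module Defs where

open import Data.Nat using (ℕ; zero; suc; _≤_; _<_; _≡ᵇ_; _<ᵇ_)
open import Data.Bool using (if_then_else_)
open import Data.List using (List; []; _∷_)
open import Data.Product using (Σ; ∃; _×_; _,_)
open import Data.Sum using (_⊎_)
open import Relation.Nullary using (¬_)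
open import Relation.Binary.PropositionalEquality using (_≡_)
open import Relation.Binary.Construct.Closure.ReflexiveTransitive using (Star)

-- Conventions: rows and columns are 0-indexed.  A partition is a list of
-- row lengths (weakly decreasing; entries past the end count as 0).

part : List ℕ → ℕ → ℕ
part []       _       = 0
part (x ∷ _)  zero    = x
part (_ ∷ xs) (suc i) = part xs i

IsPartition : List ℕ → Set
IsPartition p = ∀ i → part p (suc i) ≤ part p i

_⊆ₚ_ : List ℕ → List ℕ → Set
mu ⊆ₚ lam = ∀ i → part mu i ≤ part lam i

InShape : List ℕ → List ℕ → ℕ → ℕ → Set
InShape lam mu i j = part mu i ≤ j × j < part lam i

-- Nonempty subsets of {1,2}.
data SV : Set where
  s1 s2 s12 : SV

minV : SV → ℕ
minV s1  = 1
minV s2  = 2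
minV s12 = 1

maxV : SV → ℕ
maxV s1  = 1
maxV s2  = 2
maxV s12 = 2

Has2 : SV → Set
Has2 s = maxV s ≡ 2

Has1 : SV → Set
Has1 s = minV s ≡ 1

-- A filling: only its values on boxes of lam/mu are meaningful.
Filling : Set
Filling = ℕ → ℕ → SV

module _ (lam mu : List ℕ) where

  Is12SV : Filling → Set
  Is12SV T = ∀ i k → InShape lam mu i k → InShape lam mu (suc i) k →
             maxV (T i k) ≤ minV (T (suc i) k)

  IsSVRPP : Filling → Set
  IsSVRPP T = Is12SV T ×
              (∀ i k → InShape lam mu i k → InShape lam mu i (suc k) →
                 maxV (T i k) ≤ minV (T i (suc k)))

  NonemptyCol : ℕ → Set
  NonemptyCol k = ∃ λ i → InShape lam mu i k

  OnePure : Filling → ℕ → Set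
  OnePure T k = NonemptyCol k × (∀ i → InShape lam mu i k → T i k ≡ s1)

  TwoPure : Filling → ℕ → Set
  TwoPure T k = NonemptyCol k × (∀ i → InShape lam mu i k → T i k ≡ s2)

  Mixed : Filling → ℕ → Set
  Mixed T k = NonemptyCol k × ¬ OnePure T k × ¬ TwoPure T k

  IsSep : Filling → ℕ → ℕ → Set
  IsSep T k r = InShape lam mu r k × Has2 (T r k) ×
                (∀ r' → r' < r → InShape lam mu r' k → ¬ Has2 (T r' k))

  IsLast1 : Filling → ℕ → ℕ → Set
  IsLast1 T k s = InShape lam mu s k × Has1 (T s k) ×
                  (∀ s' → s < s' → InShape lam mu s' k → ¬ Has1 (T s' k))

  HasBoth : Filling → ℕ → Set
  HasBoth T k = ∃ λ i → InShape lam mu i k × T i k ≡ s12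

  Benign : Filling → Set
  Benign T = ∀ k k' r r' → k < k' → Mixed T k → Mixed T k' →
             (∀ m → k < m → m < k' → ¬ Mixed T m) →
             IsSep T k r → IsSep T k' r' →
             r' ≤ r × (HasBoth T k' → r' < r)

  Descent : Filling → ℕ → Set
  Descent T k = ∃ λ i → InShape lam mu i k × InShape lam mu i (suc k) ×
                maxV (T i k) ≡ 2 × minV (T i (suc k)) ≡ 1

resM1 : Filling → ℕ → ℕ → Filling
resM1 T k r i j =
  if j ≡ᵇ k then s1
  else if j ≡ᵇ suc k then
    (if i <ᵇ r then s1 else if i ≡ᵇ r then T r k else s2)
  else T i j

res2M : Filling → ℕ → ℕ → Filling
res2M T k s i j =
  if j ≡ᵇ suc k then s2
  else if j ≡ᵇ k then
    (if i <ᵇ s then s1 else if i ≡ᵇ s then T s (suc k) else s2)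
  else T i j

res21 : Filling → ℕ → Filling
res21 T k i j =
  if j ≡ᵇ k then s1
  else if j ≡ᵇ suc k then s2
  else T i j

module _ (lam mu : List ℕ) where

  AgreeOn : Filling → Filling → Set
  AgreeOn Q F = ∀ i j → InShape lam mu i j → Q i j ≡ F i j

  IsRes : Filling → ℕ → Filling → Set
  IsRes P k Q =
      (Mixed lam mu P k × OnePure lam mu P (suc k) ×
        ∃ λ r → IsSep lam mu P k r × AgreeOn Q (resM1 P k r))
    ⊎ ((TwoPure lam mu P k × Mixed lam mu P (suc k) ×
        ∃ λ s → IsLast1 lam mu P (suc k) s × AgreeOn Q (res2M P k s))
    ⊎ (TwoPure lam mu P k × OnePure lam mu P (suc k) × AgreeOn Q (res21 P k)))

  Step : Filling → Filling → Set
  Step P Q = Benign lam mu P × ∃ λ k → Descent lam mu P k × IsRes P k Q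

  Steps : Filling → Filling → Set
  Steps = Star Step

{-# OPTIONS --safe #-}

-- Every column of a 12-SV table is described by a column state: 1-pure, 2-pure, or mixed, i.e.
-- {1} above a separating row σ, {2} below it, and {1,2} or {2} in row σ.  On a benign table each
-- move res_k merely exchanges the states of columns k and k+1, so resolution becomes a rewriting
-- system on sequences of column states.  Its descents are the adjacent pairs (2-pure, 1-pure),
-- (2-pure, mixed), (mixed, 1-pure) that fit the shape; benignity, which exchanges preserve, rules
-- out a descent between two mixed columns.  Exchanges move 1-pure columns left and 2-pure columns
-- right, so the system terminates, and two descents either commute or overlap in a pattern
-- (2-pure, mixed, 1-pure) resolved by the braid relation.  Newman's lemma then yields a unique
-- normal form, and the normal forms are exactly the tables without descents, the SVRPPs.

module Submission where

open import Defs
open import Data.Bool using (Bool; true; false; if_then_else_)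
open import Data.Empty using (⊥; ⊥-elim)
open import Data.List using (List; []; _∷_; length)
open import Data.Nat using (ℕ; zero; suc; pred; _+_; _∸_; _≤_; _<_; z≤n; s≤s; _≡ᵇ_; _<ᵇ_; _≤?_)
open import Data.Nat.Induction using (<-wellFounded)
open import Data.Nat.Properties
open import Data.Product using (Σ; ∃; ∃₂; _×_; _,_; proj₁; proj₂)
open import Data.Sum using (_⊎_; inj₁; inj₂)
open import Data.Unit using (⊤; tt)
open import Function using (_∘_; flip; case_of_)
open import Induction.WellFounded using (Acc; acc; module Subrelation)
open import Level using (0ℓ)
open import Relation.Binary using (Rel; IsEquivalence; Setoid)
import Relation.Binary.Construct.On as On
open import Relation.Binary.Construct.Closure.ReflexiveTransitive using (Star; ε; _◅_; _◅◅_)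
open import Relation.Binary.Construct.Closure.Transitive using (Plus; [_]; _∼⁺⟨_⟩_)
open import Relation.Binary.Definitions using (tri<; tri≈; tri>)
open import Relation.Binary.PropositionalEquality
open import Relation.Binary.Rewriting using (IsNormalForm; StronglyNormalizing)
open import Relation.Nullary using (¬_; Dec; yes; no; _×-dec_; map′)
open import Relation.Unary using (Decidable)

private variable
  i j k m : ℕ

least : {P : ℕ → Set} → Decidable P → ∀ v → (∃ λ n → n < v × P n) →
        ∃ λ n → P n × (∀ {m} → m < n → ¬ P m)
least P? zero    (_ , () , _)
least P? (suc v) (n , n<1+v , Pn) with anyUpTo? P? v
... | yes below = least P? v below
... | no none   = n , Pn , λ m<n Pm → none (_ , <-≤-trans m<n (≤-pred n<1+v) , Pm)

transpose : ℕ → ℕ → ℕ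
transpose zero    zero          = 1
transpose zero    (suc zero)    = 0
transpose zero    (suc (suc j)) = suc (suc j)
transpose (suc k) zero          = zero
transpose (suc k) (suc j)       = suc (transpose k j)

transpose-here : ∀ k → transpose k k ≡ suc k
transpose-here zero    = refl
transpose-here (suc k) = cong suc (transpose-here k)

transpose-there : ∀ k → transpose k (suc k) ≡ k
transpose-there zero    = refl
transpose-there (suc k) = cong suc (transpose-there k)

transpose-below : ∀ {k j} → j < k → transpose k j ≡ j
transpose-below {suc k} {zero}  _         = refl
transpose-below {suc k} {suc j} (s≤s j<k) = cong suc (transpose-below j<k)

transpose-above : ∀ {k j} → suc k < j → transpose k j ≡ j
transpose-above {zero}  {suc zero}    (s≤s ())
transpose-above {zero}  {suc (suc j)} _           = refl
transpose-above {suc k} {suc j}       (s≤s 1+k<j) = cong suc (transpose-above 1+k<j)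

transpose-apart : ∀ {k j} → j < k ⊎ suc k < j → transpose k j ≡ j
transpose-apart (inj₁ j<k)   = transpose-below j<k
transpose-apart (inj₂ 1+k<j) = transpose-above 1+k<j

transpose-involutive : ∀ k j → transpose k (transpose k j) ≡ j
transpose-involutive zero    zero          = refl
transpose-involutive zero    (suc zero)    = refl
transpose-involutive zero    (suc (suc j)) = refl
transpose-involutive (suc k) zero          = refl
transpose-involutive (suc k) (suc j)       = cong suc (transpose-involutive k j)

transpose-braid : ∀ k j → transpose k (transpose (suc k) (transpose k j))
                        ≡ transpose (suc k) (transpose k (transpose (suc k) j))
transpose-braid zero    zero                = refl
transpose-braid zero    (suc zero)          = refl
transpose-braid zero    (suc (suc zero))    = refl
transpose-braid zero    (suc (suc (suc j))) = refl
transpose-braid (suc k) zero                = refl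
transpose-braid (suc k) (suc j)             = cong suc (transpose-braid k j)

transpose-comm : ∀ k k' j → suc k < k' → transpose k (transpose k' j) ≡ transpose k' (transpose k j)
transpose-comm zero    (suc zero)     _             (s≤s ())
transpose-comm zero    (suc (suc k')) zero          _         = refl
transpose-comm zero    (suc (suc k')) (suc zero)    _         = refl
transpose-comm zero    (suc (suc k')) (suc (suc j)) _         = refl
transpose-comm (suc k) (suc k')       zero          _         = refl
transpose-comm (suc k) (suc k')       (suc j)       (s≤s 1+k<k') = cong suc (transpose-comm k k' j 1+k<k')

transpose-mono : ∀ k {a b} → a < b → ¬ (a ≡ k × b ≡ suc k) → transpose k a < transpose k b
transpose-mono zero    {zero}        {suc zero}    _         not-kk = ⊥-elim (not-kk (refl , refl))
transpose-mono zero    {zero}        {suc (suc b)} _         _      = s≤s (s≤s z≤n)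
transpose-mono zero    {suc zero}    {suc (suc b)} _         _      = s≤s z≤n
transpose-mono zero    {suc (suc a)} {suc (suc b)} a<b       _      = a<b
transpose-mono zero    {suc zero}    {suc zero}    (s≤s ())  _
transpose-mono zero    {suc (suc a)} {suc zero}    (s≤s ())  _
transpose-mono (suc k) {zero}        {suc b}       _         _      = s≤s z≤n
transpose-mono (suc k) {suc a}       {suc b}       (s≤s a<b) not-kk =
  s≤s (transpose-mono k a<b λ { (refl , refl) → not-kk (refl , refl) })

swapAt : {A : Set} → ℕ → (ℕ → A) → ℕ → A
swapAt k f = f ∘ transpose k

swapAt-elim : ∀ {A : Set} (P : ℕ → A → Set) {f k} → P k (f (suc k)) → P (suc k) (f k) →
              (∀ {j} → j < k ⊎ suc k < j → P j (f j)) → ∀ j → P j (swapAt k f j)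
swapAt-elim P {f} {k} here there apart j with <-cmp j k
... | tri< j<k _ _ = subst (P j ∘ f) (sym (transpose-apart (inj₁ j<k))) (apart (inj₁ j<k))
... | tri≈ _ refl _ = subst (P j ∘ f) (sym (transpose-here k)) here
... | tri> _ _ k<j with m≤n⇒m<n∨m≡n k<j
...   | inj₁ 1+k<j = subst (P j ∘ f) (sym (transpose-apart (inj₂ 1+k<j))) (apart (inj₂ 1+k<j))
...   | inj₂ refl  = subst (P j ∘ f) (sym (transpose-there k)) there

if-≡ᵇ-refl : ∀ {A : Set} k {x y : A} → (if k ≡ᵇ k then x else y) ≡ x
if-≡ᵇ-refl zero    = refl
if-≡ᵇ-refl (suc k) = if-≡ᵇ-refl k

if-≡ᵇ-≢ : ∀ {A : Set} {j k} {x y : A} → j ≢ k → (if j ≡ᵇ k then x else y) ≡ y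
if-≡ᵇ-≢ {j = zero}  {zero}  j≢k = ⊥-elim (j≢k refl)
if-≡ᵇ-≢ {j = zero}  {suc k} _   = refl
if-≡ᵇ-≢ {j = suc j} {zero}  _   = refl
if-≡ᵇ-≢ {j = suc j} {suc k} j≢k = if-≡ᵇ-≢ {j = j} {k} (j≢k ∘ cong suc)

apart⇒≢ : ∀ {j k} → j < k ⊎ suc k < j → j ≢ k × j ≢ suc k
apart⇒≢ (inj₁ j<k)   = <⇒≢ j<k , <⇒≢ (m<n⇒m<1+n j<k)
apart⇒≢ (inj₂ 1+k<j) = >⇒≢ (<-trans (n<1+n _) 1+k<j) , >⇒≢ 1+k<j

sumBelow : ℕ → (ℕ → ℕ) → ℕ
sumBelow zero    f = 0
sumBelow (suc n) f = sumBelow n f + f n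

sumBelow-cong : ∀ n {f g} → (∀ {j} → j < n → f j ≡ g j) → sumBelow n f ≡ sumBelow n g
sumBelow-cong zero    f≡g = refl
sumBelow-cong (suc n) f≡g = cong₂ _+_ (sumBelow-cong n (f≡g ∘ m<n⇒m<1+n)) (f≡g (n<1+n n))

sumBelow-decrease : ∀ {n k f g} → suc k < n → (∀ {j} → j < k ⊎ suc k < j → g j ≡ f j) →
                    g k + g (suc k) < f k + f (suc k) → sumBelow n g < sumBelow n f
sumBelow-decrease {suc n} {k} {f} {g} (s≤s 1+k≤n) g≡f pair< with m≤n⇒m<n∨m≡n 1+k≤n
... | inj₁ 1+k<n = +-mono-<-≤ (sumBelow-decrease 1+k<n g≡f pair<)
                     (≤-reflexive (g≡f (inj₂ 1+k<n)))
... | inj₂ refl = begin-strict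
  sumBelow k g + g k + g (suc k)   ≡⟨ +-assoc (sumBelow k g) _ _ ⟩
  sumBelow k g + (g k + g (suc k)) <⟨ +-monoʳ-< (sumBelow k g) pair< ⟩
  sumBelow k g + (f k + f (suc k)) ≡⟨ cong (_+ (f k + f (suc k))) (sumBelow-cong k outside) ⟩
  sumBelow k f + (f k + f (suc k)) ≡⟨ +-assoc (sumBelow k f) _ _ ⟨
  sumBelow k f + f k + f (suc k)   ∎
  where
  open ≤-Reasoning
  outside : ∀ {j} → j < k → g j ≡ f j
  outside j<k = g≡f (inj₁ j<k)


-- The library's sn&wcr⇒cr joins up to ≡; configurations below are functions, and commuting
-- exchanges only meet pointwise, so joins are taken modulo an equivalence that steps simulate.
module NewmanModulo {A : Set} {_≈_ _⟶_ : Rel A 0ℓ} (≈-equivalence : IsEquivalence _≈_)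
  (simulate : ∀ {a a' b'} → a ≈ a' → a' ⟶ b' → ∃ λ b → a ⟶ b × b ≈ b')
  (terminating : StronglyNormalizing (Plus _⟶_))
  (progress : ∀ a → IsNormalForm _⟶_ a ⊎ ∃ (a ⟶_))
  (joinable : ∀ {a b c} → a ⟶ b → a ⟶ c → ∃₂ λ d e → Star _⟶_ b d × Star _⟶_ c e × d ≈ e)
  where

  open IsEquivalence ≈-equivalence renaming (refl to ≈-refl; sym to ≈-sym; trans to ≈-trans)

  private
    ◅⁺ : ∀ {a b c} → a ⟶ b → Star _⟶_ b c → Plus _⟶_ a c
    ◅⁺ s ε       = [ s ]
    ◅⁺ s (t ◅ p) = _ ∼⁺⟨ [ s ] ⟩ ◅⁺ t p

  normalise : ∀ a → ∃ λ n → Star _⟶_ a n × IsNormalForm _⟶_ n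
  normalise a = go (terminating a)
    where
    go : ∀ {a} → Acc (flip (Plus _⟶_)) a → ∃ λ n → Star _⟶_ a n × IsNormalForm _⟶_ n
    go {a} (acc rs) with progress a
    ... | inj₁ nf      = a , ε , nf
    ... | inj₂ (_ , s) with go (rs [ s ])
    ...   | n , p , nf = n , s ◅ p , nf

  normalForm-unique : ∀ {a a' n n'} → a ≈ a' → Star _⟶_ a n → Star _⟶_ a' n' →
                      IsNormalForm _⟶_ n → IsNormalForm _⟶_ n' → n ≈ n'
  normalForm-unique {a} a≈a' = go (terminating a) a≈a'
    where
    go : ∀ {a a' n n'} → Acc (flip (Plus _⟶_)) a → a ≈ a' → Star _⟶_ a n → Star _⟶_ a' n' →
         IsNormalForm _⟶_ n → IsNormalForm _⟶_ n' → n ≈ n'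
    go _ a≈a' ε ε _ _ = a≈a'
    go _ a≈a' ε (s ◅ _) nf _ with b , s' , _ ← simulate a≈a' s = ⊥-elim (nf (b , s'))
    go _ a≈a' (s ◅ _) ε _ nf' with b , s' , _ ← simulate (≈-sym a≈a') s = ⊥-elim (nf' (b , s'))
    go (acc rs) a≈a' (s₁ ◅ p₁) (s₂ ◅ p₂) nf nf' with simulate a≈a' s₂
    ... | _ , s₂' , d₂'≈d₂ with joinable s₁ s₂'
    ...   | e₁ , e₂ , r₁ , r₂ , e₁≈e₂ with normalise e₁ | normalise e₂
    ...     | m₁ , q₁ , nf₁ | m₂ , q₂ , nf₂ =
      ≈-trans (go (rs [ s₁ ]) ≈-refl p₁ (r₁ ◅◅ q₁) nf nf₁)
        (≈-trans (go (rs (◅⁺ s₁ r₁)) e₁≈e₂ q₁ q₂ nf₁ nf₂)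
          (go (rs [ s₂' ]) d₂'≈d₂ (r₂ ◅◅ q₂) p₂ nf₂ nf'))

minV≤maxV : ∀ v → minV v ≤ maxV v
minV≤maxV s1  = ≤-refl
minV≤maxV s2  = ≤-refl
minV≤maxV s12 = s≤s z≤n

¬Has2⇒s1 : ∀ v → ¬ Has2 v → v ≡ s1
¬Has2⇒s1 s1  _    = refl
¬Has2⇒s1 s2  ¬has = ⊥-elim (¬has refl)
¬Has2⇒s1 s12 ¬has = ⊥-elim (¬has refl)

2≤minV⇒s2 : ∀ v → 2 ≤ minV v → v ≡ s2
2≤minV⇒s2 s2 _ = refl
2≤minV⇒s2 s1  (s≤s ())
2≤minV⇒s2 s12 (s≤s ())

ordered-or-descent : ∀ u v → maxV u ≤ minV v ⊎ (maxV u ≡ 2 × minV v ≡ 1)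
ordered-or-descent s1  s1  = inj₁ ≤-refl
ordered-or-descent s1  s2  = inj₁ (s≤s z≤n)
ordered-or-descent s1  s12 = inj₁ ≤-refl
ordered-or-descent s2  s1  = inj₂ (refl , refl)
ordered-or-descent s2  s2  = inj₁ ≤-refl
ordered-or-descent s2  s12 = inj₂ (refl , refl)
ordered-or-descent s12 s1  = inj₂ (refl , refl)
ordered-or-descent s12 s2  = inj₁ ≤-refl
ordered-or-descent s12 s12 = inj₂ (refl , refl)

-- mix σ b: the column is {1} above row σ and {2} below it; row σ is {1,2} if b, else {2}.
data ColState : Set where
  ones twos : ColState
  mix       : ℕ → Bool → ColState

splitAt : ℕ → SV → ℕ → SV
splitAt r v i = if i <ᵇ r then s1 else if i ≡ᵇ r then v else s2

sepValue : Bool → SV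
sepValue true  = s12
sepValue false = s2

entry : ColState → ℕ → SV
entry ones      _ = s1
entry twos      _ = s2
entry (mix σ b)   = splitAt σ (sepValue b)

lastOne : ℕ → Bool → ℕ
lastOne σ true  = σ
lastOne σ false = pred σ

Config : Set
Config = ℕ → ColState

fill : Config → Filling
fill C i j = entry (C j) i

sepValue-has2 : ∀ b → Has2 (sepValue b)
sepValue-has2 true  = refl
sepValue-has2 false = refl

sepValue≢s1 : ∀ b → sepValue b ≢ s1
sepValue≢s1 true  ()
sepValue≢s1 false ()

sepValue-injective : ∀ b b' → sepValue b ≡ sepValue b' → b ≡ b'
sepValue-injective true  true  _ = refl
sepValue-injective false false _ = refl

splitAt-above : ∀ {r v i} → i < r → splitAt r v i ≡ s1
splitAt-above {suc r} {i = zero}  _         = refl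
splitAt-above {suc r} {i = suc i} (s≤s i<r) = splitAt-above i<r

splitAt-at : ∀ r v → splitAt r v r ≡ v
splitAt-at zero    v = refl
splitAt-at (suc r) v = splitAt-at r v

splitAt-below : ∀ {r v i} → r < i → splitAt r v i ≡ s2
splitAt-below {zero}  {i = suc i} _         = refl
splitAt-below {suc r} {i = suc i} (s≤s r<i) = splitAt-below r<i

splitAt-shift : ∀ p i → splitAt p s1 i ≡ splitAt (suc p) s2 i
splitAt-shift zero    zero          = refl
splitAt-shift zero    (suc zero)    = refl
splitAt-shift zero    (suc (suc i)) = refl
splitAt-shift (suc p) zero          = refl
splitAt-shift (suc p) (suc i)       = splitAt-shift p i

pred≤lastOne : ∀ σ b → pred σ ≤ lastOne σ b
pred≤lastOne σ true  = pred[n]≤n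
pred≤lastOne σ false = ≤-refl

splitAt-has1 : ∀ σ b i → Has1 (splitAt σ (sepValue b) i) → i ≤ lastOne σ b
splitAt-has1 σ b i has1 with <-cmp i σ
... | tri< i<σ _ _ = ≤-trans (<⇒≤pred i<σ) (pred≤lastOne σ b)
... | tri> _ _ σ<i with () ← trans (sym has1) (cong minV (splitAt-below {v = sepValue b} σ<i))
splitAt-has1 σ true  i has1 | tri≈ _ refl _ = ≤-refl
splitAt-has1 σ false i has1 | tri≈ _ refl _ with () ← trans (sym has1) (cong minV (splitAt-at σ s2))

splitAt-s12 : ∀ σ b i → splitAt σ (sepValue b) i ≡ s12 → b ≡ true
splitAt-s12 σ true  i _ = refl
splitAt-s12 σ false i is12 with <-cmp i σ
... | tri< i<σ _ _   with () ← trans (sym is12) (splitAt-above i<σ)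
... | tri≈ _ refl _  with () ← trans (sym is12) (splitAt-at σ s2)
... | tri> _ _ σ<i   with () ← trans (sym is12) (splitAt-below σ<i)

splitAt-increasing : ∀ σ b i → maxV (splitAt σ (sepValue b) i) ≤ minV (splitAt σ (sepValue b) (suc i))
splitAt-increasing zero          true  zero    = ≤-refl
splitAt-increasing zero          false zero    = ≤-refl
splitAt-increasing zero          b     (suc i) = ≤-refl
splitAt-increasing (suc zero)    true  zero    = ≤-refl
splitAt-increasing (suc zero)    false zero    = s≤s z≤n
splitAt-increasing (suc (suc σ)) b     zero    = ≤-refl
splitAt-increasing (suc σ)       b     (suc i) = splitAt-increasing σ b i

entry-increasing : ∀ c i → maxV (entry c i) ≤ minV (entry c (suc i))
entry-increasing ones      i = ≤-refl
entry-increasing twos      i = ≤-refl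
entry-increasing (mix σ b) i = splitAt-increasing σ b i

part-antitone : ∀ p → IsPartition p → ∀ {i j} → i ≤ j → part p j ≤ part p i
part-antitone p p-partition {j = zero}  z≤n = ≤-refl
part-antitone p p-partition {j = suc j} i≤1+j with m≤n⇒m<n∨m≡n i≤1+j
... | inj₁ (s≤s i≤j) = ≤-trans (p-partition j) (part-antitone p p-partition i≤j)
... | inj₂ refl      = ≤-refl

part-beyond : ∀ p i → length p ≤ i → part p i ≡ 0
part-beyond []      i       _         = refl
part-beyond (x ∷ p) (suc i) (s≤s len≤i) = part-beyond p i len≤i

module Shape (lam mu : List ℕ) (lam-partition : IsPartition lam) (mu-partition : IsPartition mu) where

  Box : ℕ → ℕ → Set
  Box = InShape lam mu

  box? : ∀ i k → Dec (Box i k)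
  box? i k = (part mu i ≤? k) ×-dec (suc k ≤? part lam i)

  row-bound : Box i k → i < length lam
  row-bound {i} (_ , k<λᵢ) with length lam ≤? i
  ... | no  len≰i = ≰⇒> len≰i
  ... | yes len≤i with () ← subst (_ <_) (part-beyond lam i len≤i) k<λᵢ

  column-bound : Box i k → k < part lam 0
  column-bound (_ , k<λᵢ) = <-≤-trans k<λᵢ (part-antitone lam lam-partition z≤n)

  column-convex : Box i k → Box j k → i ≤ m → m ≤ j → Box m k
  column-convex (μᵢ≤k , _) (_ , k<λⱼ) i≤m m≤j =
    ≤-trans (part-antitone mu mu-partition i≤m) μᵢ≤k , <-≤-trans k<λⱼ (part-antitone lam lam-partition m≤j)

  row-convex : ∀ {k'} → Box i k → Box i k' → k ≤ m → m ≤ k' → Box i m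
  row-convex (μᵢ≤k , _) (_ , k'<λᵢ) k≤m m≤k' = ≤-trans μᵢ≤k k≤m , ≤-<-trans m≤k' k'<λᵢ

  box-left : Box j k → j ≤ i → Box i (suc k) → Box i k
  box-left (μⱼ≤k , _) j≤i (_ , 1+k<λᵢ) =
    ≤-trans (part-antitone mu mu-partition j≤i) μⱼ≤k , <-trans (n<1+n _) 1+k<λᵢ

  box-right : Box i k → i ≤ j → Box j (suc k) → Box i (suc k)
  box-right (μᵢ≤k , _) i≤j (_ , 1+k<λⱼ) =
    m≤n⇒m≤1+n μᵢ≤k , <-≤-trans 1+k<λⱼ (part-antitone lam lam-partition i≤j)

  column-increasing : ∀ {T i j k} → Is12SV lam mu T → Box i k → Box j k → i < j →
                      maxV (T i k) ≤ minV (T j k)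
  column-increasing {T} {j = suc j} t12 bi bj (s≤s i≤j) with m≤n⇒m<n∨m≡n i≤j
  ... | inj₂ refl = t12 _ _ bi bj
  ... | inj₁ i<j  =
    ≤-trans (column-increasing t12 bi bj' i<j) (≤-trans (minV≤maxV (T j _)) (t12 j _ bj' bj))
    where bj' = column-convex bi bj i≤j (n≤1+n j)

  -- mix σ b occurs in column k: row σ is a box, and for b = false so is row σ - 1, holding the last 1.
  data MixFits (k : ℕ) : ℕ → Bool → Set where
    both  : ∀ {σ} → Box σ k → MixFits k σ true
    split : ∀ {p} → Box p k → Box (suc p) k → MixFits k (suc p) false

  Fits : ℕ → ColState → Set
  Fits k (mix σ b) = MixFits k σ b
  Fits k _         = ⊤

  Valid : Config → Set
  Valid C = ∀ k → Fits k (C k)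

  sep-box : ∀ {k σ b} → MixFits k σ b → Box σ k
  sep-box (both bσ)    = bσ
  sep-box (split _ bσ) = bσ

  lastOne-box : ∀ {k σ b} → MixFits k σ b → Box (lastOne σ b) k
  lastOne-box (both bσ)    = bσ
  lastOne-box (split bp _) = bp

  mixFits-between : ∀ {k σ b} → MixFits k σ b → MixFits (suc (suc k)) σ b → MixFits (suc k) σ b
  mixFits-between (both bσ)     (both bσ')      = both (row-convex bσ bσ' (n≤1+n _) (n≤1+n _))
  mixFits-between (split bp bσ) (split bp' bσ') =
    split (row-convex bp bp' (n≤1+n _) (n≤1+n _)) (row-convex bσ bσ' (n≤1+n _) (n≤1+n _))

  mixFits-left : ∀ {i k σ b} → Box i k → i ≤ lastOne σ b → MixFits (suc k) σ b → MixFits k σ b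
  mixFits-left bi i≤σ (both bσ)     = both (box-left bi i≤σ bσ)
  mixFits-left bi i≤p (split bp bσ) = split (box-left bi i≤p bp) (box-left bi (m≤n⇒m≤1+n i≤p) bσ)

  mixFits-right : ∀ {i k σ b} → σ ≤ i → Box i (suc k) → MixFits k σ b → MixFits (suc k) σ b
  mixFits-right σ≤i bi (both bσ)     = both (box-right bσ σ≤i bi)
  mixFits-right σ≤i bi (split bp bσ) = split (box-right bp (≤-trans (n≤1+n _) σ≤i) bi) (box-right bσ σ≤i bi)

  mixFits? : ∀ k σ b → Dec (MixFits k σ b)
  mixFits? k σ true with box? σ k
  ... | yes bσ = yes (both bσ)
  ... | no ¬bσ = no λ { (both bσ) → ¬bσ bσ }
  mixFits? k zero    false = no λ ()
  mixFits? k (suc p) false with box? p k | box? (suc p) k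
  ... | yes bp | yes bσ = yes (split bp bσ)
  ... | no ¬bp | _      = no λ { (split bp _) → ¬bp bp }
  ... | _      | no ¬bσ = no λ { (split _ bσ) → ¬bσ bσ }

  lastOne<sep : ∀ {k σ σ' b'} → MixFits k σ' b' → σ' ≤ σ → (b' ≡ true → σ' < σ) → lastOne σ' b' < σ
  lastOne<sep (both _)    _     strict = strict refl
  lastOne<sep (split _ _) 1+p≤σ _      = 1+p≤σ

  lastOne-has1 : ∀ {k σ b} → MixFits k σ b → Has1 (splitAt σ (sepValue b) (lastOne σ b))
  lastOne-has1 {σ = σ}     (both _)    = cong minV (splitAt-at σ s12)
  lastOne-has1 {σ = suc p} (split _ _) = cong minV (splitAt-above (n<1+n p))

  ColumnIs : Filling → ℕ → ColState → Set
  ColumnIs P k c = ∀ i → Box i k → P i k ≡ entry c i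

  lastOne-split : ∀ {P k σ b} → MixFits k σ b → ColumnIs P k (mix σ b) →
                  ∀ i → splitAt (lastOne σ b) (P (lastOne σ b) k) i ≡ splitAt σ (sepValue b) i
  lastOne-split {σ = σ} (both bσ) col i = cong (λ v → splitAt σ v i) (trans (col σ bσ) (splitAt-at σ s12))
  lastOne-split {σ = suc p} (split bp _) col i =
    trans (cong (λ v → splitAt p v i) (trans (col p bp) (splitAt-above (n<1+n p)))) (splitAt-shift p i)

  mix-not-ones : ∀ P {k σ b} → MixFits k σ b → ColumnIs P k (mix σ b) → ¬ ColumnIs P k ones
  mix-not-ones P {σ = σ} {b} fits col col₁ =
    sepValue≢s1 b (trans (sym (splitAt-at σ _)) (trans (sym (col σ bσ)) (col₁ σ bσ)))
    where bσ = sep-box fits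

  mix-not-twos : ∀ P {k σ b} → MixFits k σ b → ColumnIs P k (mix σ b) → ¬ ColumnIs P k twos
  mix-not-twos P {σ = σ} (both bσ) col col₂
    with () ← trans (sym (splitAt-at σ s12)) (trans (sym (col σ bσ)) (col₂ σ bσ))
  mix-not-twos P {σ = suc p} (split bp _) col col₂
    with () ← trans (sym (splitAt-above (n<1+n p))) (trans (sym (col p bp)) (col₂ p bp))

  columnIs-unique : ∀ {P k c c'} → NonemptyCol lam mu k → Fits k c → Fits k c' →
                    ColumnIs P k c → ColumnIs P k c' → c ≡ c'
  columnIs-unique {c = ones} {ones} _ _ _ _ _ = refl
  columnIs-unique {c = twos} {twos} _ _ _ _ _ = refl
  columnIs-unique {c = ones} {twos} (i , bi) _ _ col col' with () ← trans (sym (col i bi)) (col' i bi)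
  columnIs-unique {c = twos} {ones} (i , bi) _ _ col col' with () ← trans (sym (col i bi)) (col' i bi)
  columnIs-unique {P} {c = ones}    {mix _ _} _ _ fits' col col' = ⊥-elim (mix-not-ones P fits' col' col)
  columnIs-unique {P} {c = twos}    {mix _ _} _ _ fits' col col' = ⊥-elim (mix-not-twos P fits' col' col)
  columnIs-unique {P} {c = mix _ _} {ones}    _ fits _ col col'  = ⊥-elim (mix-not-ones P fits col col')
  columnIs-unique {P} {c = mix _ _} {twos}    _ fits _ col col'  = ⊥-elim (mix-not-twos P fits col col')
  columnIs-unique {c = mix σ b} {mix σ' b'} _ fits fits' col col' with <-cmp σ σ'
  ... | tri< σ<σ' _ _ = ⊥-elim (sepValue≢s1 b (begin
    sepValue b                 ≡⟨ splitAt-at σ _ ⟨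
    splitAt σ (sepValue b) σ   ≡⟨ trans (sym (col σ (sep-box fits))) (col' σ (sep-box fits)) ⟩
    splitAt σ' (sepValue b') σ ≡⟨ splitAt-above σ<σ' ⟩
    s1                         ∎))
    where open ≡-Reasoning
  ... | tri> _ _ σ'<σ = ⊥-elim (sepValue≢s1 b' (begin
    sepValue b'                 ≡⟨ splitAt-at σ' _ ⟨
    splitAt σ' (sepValue b') σ' ≡⟨ trans (sym (col' σ' (sep-box fits'))) (col σ' (sep-box fits')) ⟩
    splitAt σ (sepValue b) σ'   ≡⟨ splitAt-above σ'<σ ⟩
    s1                          ∎))
    where open ≡-Reasoning
  ... | tri≈ _ refl _ = cong (mix σ) (sepValue-injective b b' (begin
    sepValue b                ≡⟨ splitAt-at σ _ ⟨
    splitAt σ (sepValue b) σ  ≡⟨ trans (sym (col σ (sep-box fits))) (col' σ (sep-box fits)) ⟩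
    splitAt σ (sepValue b') σ ≡⟨ splitAt-at σ _ ⟩
    sepValue b'               ∎))
    where open ≡-Reasoning

  width : ℕ
  width = part lam 0

  data DescentPair (k : ℕ) : ColState → ColState → Set where
    twos-ones : ∀ {i} → Box i k → Box i (suc k) → DescentPair k twos ones
    twos-mix  : ∀ {σ b} → MixFits k σ b → DescentPair k twos (mix σ b)
    mix-ones  : ∀ {σ b} → MixFits (suc k) σ b → DescentPair k (mix σ b) ones

  descentPair? : ∀ k a b → Dec (DescentPair k a b)
  descentPair? k twos ones with anyUpTo? (λ i → box? i k ×-dec box? i (suc k)) (length lam)
  ... | yes (_ , _ , bi , bi') = yes (twos-ones bi bi')
  ... | no none                = no λ { (twos-ones bi bi') → none (_ , row-bound bi , bi , bi') }
  descentPair? k twos (mix σ b) = map′ twos-mix (λ { (twos-mix f) → f }) (mixFits? k σ b)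
  descentPair? k (mix σ b) ones = map′ mix-ones (λ { (mix-ones f) → f }) (mixFits? (suc k) σ b)
  descentPair? k ones      _         = no λ ()
  descentPair? k twos      twos      = no λ ()
  descentPair? k (mix _ _) twos      = no λ ()
  descentPair? k (mix _ _) (mix _ _) = no λ ()

  descentPair-bound : ∀ {k a b} → DescentPair k a b → k < width
  descentPair-bound (twos-ones bi _) = column-bound bi
  descentPair-bound (twos-mix f)     = column-bound (sep-box f)
  descentPair-bound (mix-ones f)     = <-trans (n<1+n _) (column-bound (sep-box f))

  descentPair-overlap : ∀ {k a b c} → DescentPair k a b → DescentPair (suc k) b c →
                        ∃₂ λ σ β → a ≡ twos × b ≡ mix σ β × c ≡ ones ×
                                   MixFits k σ β × MixFits (suc (suc k)) σ β
  descentPair-overlap (twos-mix f) (mix-ones f') = _ , _ , refl , refl , refl , f , f'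

  StateDescent : Config → ℕ → Set
  StateDescent C k = DescentPair k (C k) (C (suc k))

  descent-at : ∀ C {k a b} → C k ≡ a → C (suc k) ≡ b → DescentPair k a b → StateDescent C k
  descent-at C refl refl d = d

  data _↝_ (C : Config) : Config → Set where
    exchange : ∀ {k} → StateDescent C k → C ↝ swapAt k C

  _↝*_ : Config → Config → Set
  _↝*_ = Star _↝_

  weight : ℕ → ColState → ℕ
  weight j ones      = j
  weight j twos      = width ∸ j
  weight j (mix _ _) = 0

  measure : Config → ℕ
  measure C = sumBelow (suc width) (λ j → weight j (C j))

  weight-decrease : ∀ {k a b} → DescentPair k a b →
                    weight k b + weight (suc k) a < weight k a + weight (suc k) b
  weight-decrease {k} d@(twos-ones _ _) = begin-strict
    k + (width ∸ suc k) ≡⟨ +-comm k _ ⟩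
    (width ∸ suc k) + k <⟨ +-mono-< (∸-monoʳ-< (n<1+n k) (descentPair-bound d)) (n<1+n k) ⟩
    (width ∸ k) + suc k ∎
    where open ≤-Reasoning
  weight-decrease {k} d@(twos-mix _) = <-≤-trans (∸-monoʳ-< (n<1+n k) (descentPair-bound d)) (m≤m+n _ 0)
  weight-decrease {k} (mix-ones _)   = s≤s (≤-reflexive (+-identityʳ k))

  measure-decrease : ∀ {C D} → C ↝ D → measure D < measure C
  measure-decrease {C} (exchange {k} d) =
    sumBelow-decrease (s≤s (descentPair-bound d)) (λ {j} apart → cong (weight j ∘ C) (transpose-apart apart)) pair
    where
    pair : weight k (C (transpose k k)) + weight (suc k) (C (transpose k (suc k))) <
           weight k (C k) + weight (suc k) (C (suc k))
    pair rewrite transpose-here k | transpose-there k = weight-decrease d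

  ↝-terminating : StronglyNormalizing (Plus _↝_)
  ↝-terminating = Subrelation.wellFounded decrease⁺ (On.wellFounded measure <-wellFounded)
    where
    decrease⁺ : ∀ {C D} → Plus _↝_ D C → measure C < measure D
    decrease⁺ [ s ]           = measure-decrease s
    decrease⁺ (_ ∼⁺⟨ p ⟩ q) = <-trans (decrease⁺ q) (decrease⁺ p)

  ↝-progress : ∀ C → IsNormalForm _↝_ C ⊎ ∃ (C ↝_)
  ↝-progress C with anyUpTo? (λ k → descentPair? k (C k) (C (suc k))) width
  ... | yes (_ , _ , d) = inj₂ (_ , exchange d)
  ... | no none         = inj₁ λ { (_ , exchange d) → none (_ , descentPair-bound d , d) }

  ↝-simulate : ∀ {C C' D'} → C ≗ C' → C' ↝ D' → ∃ λ D → C ↝ D × D ≗ D'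
  ↝-simulate {C} C≗C' (exchange {k} d) =
    _ , exchange (descent-at C (C≗C' k) (C≗C' (suc k)) d) , C≗C' ∘ transpose k

  descent-preserved : ∀ {C k k'} → suc k < k' ⊎ suc k' < k → StateDescent C k → StateDescent (swapAt k' C) k
  descent-preserved {C} {k' = k'} (inj₁ 1+k<k') =
    descent-at (swapAt k' C) (cong C (transpose-below (<-trans (n<1+n _) 1+k<k'))) (cong C (transpose-below 1+k<k'))
  descent-preserved {C} {k' = k'} (inj₂ 1+k'<k) =
    descent-at (swapAt k' C) (cong C (transpose-above 1+k'<k)) (cong C (transpose-above (m<n⇒m<1+n 1+k'<k)))

  Joinable : Config → Config → Set
  Joinable D₁ D₂ = ∃₂ λ E₁ E₂ → D₁ ↝* E₁ × D₂ ↝* E₂ × E₁ ≗ E₂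

  commuting-join : ∀ {C k₁ k₂} → suc k₁ < k₂ → StateDescent C k₁ → StateDescent C k₂ →
                   Joinable (swapAt k₁ C) (swapAt k₂ C)
  commuting-join {C} {k₁} {k₂} 1+k₁<k₂ d₁ d₂ =
    _ , _ , exchange (descent-preserved {C} (inj₂ 1+k₁<k₂) d₂) ◅ ε ,
            exchange (descent-preserved {C} (inj₁ 1+k₁<k₂) d₁) ◅ ε ,
    λ j → cong C (transpose-comm k₁ k₂ j 1+k₁<k₂)

  braid-join : ∀ {C k σ β} → C k ≡ twos → C (suc k) ≡ mix σ β → C (suc (suc k)) ≡ ones →
               MixFits k σ β → MixFits (suc (suc k)) σ β → Joinable (swapAt k C) (swapAt (suc k) C)
  braid-join {C} {k} c₀ c₁ c₂ f₀ f₂ =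
    _ , _ , exchange twos-ones-right ◅ exchange mix-ones-left ◅ ε ,
            exchange twos-ones-left ◅ exchange twos-mix-right ◅ ε ,
    λ j → cong C (transpose-braid k j)
    where
    f₁ = mixFits-between f₀ f₂
    k<1+k = n<1+n k
    1+k<2+k = n<1+n (suc k)
    twos-ones-right : StateDescent (swapAt k C) (suc k)
    twos-ones-right = descent-at (swapAt k C)
      (trans (cong C (transpose-there k)) c₀)
      (trans (cong C (transpose-above 1+k<2+k)) c₂)
      (twos-ones (sep-box f₁) (sep-box f₂))
    mix-ones-left : StateDescent (swapAt (suc k) (swapAt k C)) k
    mix-ones-left = descent-at (swapAt (suc k) (swapAt k C))
      (trans (cong (C ∘ transpose k) (transpose-below k<1+k)) (trans (cong C (transpose-here k)) c₁))
      (trans (cong (C ∘ transpose k) (transpose-here (suc k))) (trans (cong C (transpose-above 1+k<2+k)) c₂))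
      (mix-ones f₁)
    twos-ones-left : StateDescent (swapAt (suc k) C) k
    twos-ones-left = descent-at (swapAt (suc k) C)
      (trans (cong C (transpose-below k<1+k)) c₀)
      (trans (cong C (transpose-here (suc k))) c₂)
      (twos-ones (sep-box f₀) (sep-box f₁))
    twos-mix-right : StateDescent (swapAt k (swapAt (suc k) C)) (suc k)
    twos-mix-right = descent-at (swapAt k (swapAt (suc k) C))
      (trans (cong (C ∘ transpose (suc k)) (transpose-there k)) (trans (cong C (transpose-below k<1+k)) c₀))
      (trans (cong (C ∘ transpose (suc k)) (transpose-above 1+k<2+k)) (trans (cong C (transpose-there (suc k))) c₁))
      (twos-mix f₁)

  ordered-join : ∀ {C k₁ k₂} → k₁ < k₂ → StateDescent C k₁ → StateDescent C k₂ →
                 Joinable (swapAt k₁ C) (swapAt k₂ C)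
  ordered-join {C} k₁<k₂ d₁ d₂ with m≤n⇒m<n∨m≡n k₁<k₂
  ... | inj₁ 1+k₁<k₂ = commuting-join {C} 1+k₁<k₂ d₁ d₂
  ... | inj₂ refl with _ , _ , c₀ , c₁ , c₂ , f₀ , f₂ ← descentPair-overlap d₁ d₂ =
    braid-join {C} c₀ c₁ c₂ f₀ f₂

  ↝-joinable : ∀ {C D₁ D₂} → C ↝ D₁ → C ↝ D₂ → Joinable D₁ D₂
  ↝-joinable (exchange {k₁} d₁) (exchange {k₂} d₂) with <-cmp k₁ k₂
  ... | tri< k₁<k₂ _ _ = ordered-join k₁<k₂ d₁ d₂
  ... | tri≈ _ refl _  = _ , _ , ε , ε , λ _ → refl
  ... | tri> _ _ k₂<k₁ with E₂ , E₁ , p₂ , p₁ , E₂≗E₁ ← ordered-join k₂<k₁ d₂ d₁ =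
    E₁ , E₂ , p₁ , p₂ , sym ∘ E₂≗E₁

  open NewmanModulo (Setoid.isEquivalence (ℕ →-setoid ColState))
                    ↝-simulate ↝-terminating ↝-progress ↝-joinable public

  IsMix : ColState → Set
  IsMix (mix _ _) = ⊤
  IsMix _         = ⊥

  BenignStates : Config → Set
  BenignStates C = ∀ {k k' σ σ' b b'} → k < k' → C k ≡ mix σ b → C k' ≡ mix σ' b' →
                   (∀ {m} → k < m → m < k' → ¬ IsMix (C m)) → σ' ≤ σ × (b' ≡ true → σ' < σ)

  isMix-of : ∀ {c σ b} → c ≡ mix σ b → IsMix c
  isMix-of refl = tt

  descentPair-notBothMixed : ∀ {k a b} → DescentPair k a b → IsMix a → IsMix b → ⊥
  descentPair-notBothMixed (twos-ones _ _) ()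
  descentPair-notBothMixed (twos-mix _)    ()
  descentPair-notBothMixed (mix-ones _)    _ ()

  benign-exchange : ∀ {C k} → BenignStates C → StateDescent C k → BenignStates (swapAt k C)
  benign-exchange {C} {k} benign d {k₁} {k₂} k₁<k₂ e₁ e₂ between =
    benign (transpose-mono k k₁<k₂ not-the-pair) e₁ e₂ between'
    where
    not-both : IsMix (C k) → IsMix (C (suc k)) → ⊥
    not-both = descentPair-notBothMixed d
    not-the-pair : ¬ (k₁ ≡ k × k₂ ≡ suc k)
    not-the-pair (refl , refl) =
      not-both (subst IsMix (cong C (transpose-there k)) (isMix-of e₂))
               (subst IsMix (cong C (transpose-here k)) (isMix-of e₁))
    between' : ∀ {m} → transpose k k₁ < m → m < transpose k k₂ → ¬ IsMix (C m)
    between' {m} lo hi mixed =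
      between k₁<τm τm<k₂ (subst IsMix (cong C (sym (transpose-involutive k m))) mixed)
      where
      k₁<τm = subst (_< transpose k m) (transpose-involutive k k₁)
                (transpose-mono k lo λ { (e , refl) → not-both (subst IsMix (cong C e) (isMix-of e₁)) mixed })
      τm<k₂ = subst (transpose k m <_) (transpose-involutive k k₂)
                (transpose-mono k hi λ { (refl , e) → not-both mixed (subst IsMix (cong C e) (isMix-of e₂)) })

  fits-exchanged : ∀ {k a b} → DescentPair k a b → Fits k b × Fits (suc k) a
  fits-exchanged (twos-ones _ _) = tt , tt
  fits-exchanged (twos-mix f)    = f , tt
  fits-exchanged (mix-ones f)    = tt , f

  valid-exchange : ∀ {C k} → Valid C → StateDescent C k → Valid (swapAt k C)
  valid-exchange valid d =
    swapAt-elim Fits (proj₁ (fits-exchanged d)) (proj₂ (fits-exchanged d)) (λ {j} _ → valid j)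

  Good : Config → Set
  Good C = Valid C × BenignStates C

  good-step : ∀ {C D} → Good C → C ↝ D → Good D
  good-step (valid , benign) (exchange d) = valid-exchange valid d , benign-exchange benign d

  good-steps : ∀ {C D} → Good C → C ↝* D → Good D
  good-steps good ε       = good
  good-steps good (s ◅ p) = good-steps (good-step good s) p

  _≈_ : Filling → Filling → Set
  _≈_ = AgreeOn lam mu

  ≈-trans : ∀ {P Q R} → P ≈ Q → Q ≈ R → P ≈ R
  ≈-trans P≈Q Q≈R i j b = trans (P≈Q i j b) (Q≈R i j b)

  ≈-sym : ∀ {P Q} → P ≈ Q → Q ≈ P
  ≈-sym P≈Q i j b = sym (P≈Q i j b)

  first-row-or-split : ∀ {k} r → Box r k → (∀ {i} → Box i k → r ≤ i) ⊎ MixFits k r false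
  first-row-or-split zero    _  = inj₁ λ _ → z≤n
  first-row-or-split {k} (suc p) br with box? p k
  ... | yes bp = inj₂ (split bp br)
  ... | no ¬bp = inj₁ λ bi → ≮⇒≥ λ i<1+p → ¬bp (column-convex bi br (≤-pred i<1+p) (n≤1+n p))

  columnState-fromFirstTwo : ∀ {T k} → Is12SV lam mu T → ∀ r → Box r k → Has2 (T r k) →
                             (∀ {i} → i < r → ¬ (Box i k × Has2 (T i k))) → ∃ λ c → Fits k c × ColumnIs T k c
  columnState-fromFirstTwo {T} {k} t12 r br has2 minimal = classify (T r k) refl
    where
    above : ∀ {i} → Box i k → i < r → T i k ≡ s1
    above bi i<r = ¬Has2⇒s1 _ λ has2 → minimal i<r (bi , has2)
    below : ∀ {i} → Box i k → r < i → T i k ≡ s2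
    below bi r<i = 2≤minV⇒s2 _ (≤-trans (≤-reflexive (sym has2)) (column-increasing t12 br bi r<i))
    split-column : ∀ {v} → T r k ≡ v → ∀ i → Box i k → T i k ≡ splitAt r v i
    split-column eq i bi with <-cmp i r
    ... | tri< i<r _ _  = trans (above bi i<r) (sym (splitAt-above i<r))
    ... | tri≈ _ refl _ = trans eq (sym (splitAt-at r _))
    ... | tri> _ _ r<i  = trans (below bi r<i) (sym (splitAt-below r<i))
    all-twos : T r k ≡ s2 → (∀ {i} → Box i k → r ≤ i) → ∀ i → Box i k → T i k ≡ s2
    all-twos eq r≤ i bi with m≤n⇒m<n∨m≡n (r≤ bi)
    ... | inj₁ r<i  = below bi r<i
    ... | inj₂ refl = eq
    classify : ∀ v → T r k ≡ v → ∃ λ c → Fits k c × ColumnIs T k c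
    classify s1  eq with () ← trans (sym has2) (cong maxV eq)
    classify s12 eq = mix r true , both br , split-column eq
    classify s2  eq with first-row-or-split r br
    ... | inj₂ fits = mix r false , fits , split-column eq
    ... | inj₁ r≤   = twos , tt , all-twos eq r≤

  two-at? : ∀ (T : Filling) k r → Dec (Box r k × Has2 (T r k))
  two-at? T k r = box? r k ×-dec (maxV (T r k) ≟ 2)

  columnState : ∀ {T} → Is12SV lam mu T → ∀ k → ∃ λ c → Fits k c × ColumnIs T k c
  columnState {T} t12 k with anyUpTo? (two-at? T k) (length lam)
  ... | no none = ones , tt , λ i bi → ¬Has2⇒s1 (T i k) λ has2 → none (i , row-bound bi , bi , has2)
  ... | yes found with r , (br , has2) , minimal ← least (two-at? T k) _ found =
    columnState-fromFirstTwo t12 r br has2 minimal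

  represent : ∀ {T} → Is12SV lam mu T → ∃ λ C → Valid C × T ≈ fill C
  represent t12 = (λ k → proj₁ (columnState t12 k)) , (λ k → proj₁ (proj₂ (columnState t12 k))) ,
                  λ i k bi → proj₂ (proj₂ (columnState t12 k)) i bi

  sep-unique : ∀ {P k r r'} → IsSep lam mu P k r → IsSep lam mu P k r' → r ≡ r'
  sep-unique {r = r} {r'} (br , has2 , minimal) (br' , has2' , minimal') with <-cmp r r'
  ... | tri< r<r' _ _ = ⊥-elim (minimal' r r<r' br has2)
  ... | tri≈ _ r≡r' _ = r≡r'
  ... | tri> _ _ r'<r = ⊥-elim (minimal r' r'<r br' has2')

  last1-unique : ∀ {P k s s'} → IsLast1 lam mu P k s → IsLast1 lam mu P k s' → s ≡ s'
  last1-unique {s = s} {s'} (bs , has1 , maximal) (bs' , has1' , maximal') with <-cmp s s'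
  ... | tri< s<s' _ _ = ⊥-elim (maximal s' s<s' bs' has1')
  ... | tri≈ _ s≡s' _ = s≡s'
  ... | tri> _ _ s'<s = ⊥-elim (maximal' s s'<s bs has1)

  module Representation {P : Filling} {C : Config} (valid : Valid C) (P≈C : P ≈ fill C) where

    cell : ∀ {i k c} → C k ≡ c → Box i k → P i k ≡ entry c i
    cell eq bi = trans (P≈C _ _ bi) (cong (λ c → entry c _) eq)

    mixFits : ∀ {k σ b} → C k ≡ mix σ b → MixFits k σ b
    mixFits {k} eq = subst (Fits k) eq (valid k)

    column : ∀ k → ColumnIs P k (C k)
    column k i = P≈C i k

    onePure⇒ones : ∀ {k} → OnePure lam mu P k → C k ≡ ones
    onePure⇒ones {k} (ne , col) = columnIs-unique {P} ne (valid k) tt (column k) col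

    twoPure⇒twos : ∀ {k} → TwoPure lam mu P k → C k ≡ twos
    twoPure⇒twos {k} (ne , col) = columnIs-unique {P} ne (valid k) tt (column k) col

    ones⇒onePure : ∀ {k} → C k ≡ ones → NonemptyCol lam mu k → OnePure lam mu P k
    ones⇒onePure eq ne = ne , λ i → cell eq

    twos⇒twoPure : ∀ {k} → C k ≡ twos → NonemptyCol lam mu k → TwoPure lam mu P k
    twos⇒twoPure eq ne = ne , λ i → cell eq

    mix⇒mixed : ∀ {k σ b} → C k ≡ mix σ b → Mixed lam mu P k
    mix⇒mixed eq = (_ , sep-box (mixFits eq)) ,
                   (λ pure → case trans (sym (onePure⇒ones pure)) eq of λ ()) ,
                   (λ pure → case trans (sym (twoPure⇒twos pure)) eq of λ ())

    mixed⇒mix : ∀ {k} → Mixed lam mu P k → ∃₂ λ σ b → C k ≡ mix σ b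
    mixed⇒mix {k} (ne , ¬ones , ¬twos) with C k in eq
    ... | ones    = ⊥-elim (¬ones (ones⇒onePure eq ne))
    ... | twos    = ⊥-elim (¬twos (twos⇒twoPure eq ne))
    ... | mix σ b = σ , b , refl

    isMix⇒mixed : ∀ {k} → IsMix (C k) → Mixed lam mu P k
    isMix⇒mixed {k} _ with C k in eq
    ... | mix _ _ = mix⇒mixed eq

    mix⇒sep : ∀ {k σ b} → C k ≡ mix σ b → IsSep lam mu P k σ
    mix⇒sep {σ = σ} {b} eq =
      bσ , subst Has2 (sym (trans (cell eq bσ) (splitAt-at σ _))) (sepValue-has2 b) ,
      λ r r<σ br has2 → case trans (sym has2) (cong maxV (trans (cell eq br) (splitAt-above r<σ))) of λ ()
      where bσ = sep-box (mixFits eq)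

    mix⇒last1 : ∀ {k σ b} → C k ≡ mix σ b → IsLast1 lam mu P k (lastOne σ b)
    mix⇒last1 {σ = σ} {b} eq =
      lastOne-box fits , subst Has1 (sym (cell eq (lastOne-box fits))) (lastOne-has1 fits) ,
      λ s last<s bs has1 → <⇒≱ last<s (splitAt-has1 σ b s (subst Has1 (cell eq bs) has1))
      where fits = mixFits eq

    hasBoth⇒true : ∀ {k σ b} → C k ≡ mix σ b → HasBoth lam mu P k → b ≡ true
    hasBoth⇒true {σ = σ} {b} eq (i , bi , is12) = splitAt-s12 σ b i (trans (sym (cell eq bi)) is12)

    true⇒hasBoth : ∀ {k σ} → C k ≡ mix σ true → HasBoth lam mu P k
    true⇒hasBoth {σ = σ} eq = σ , bσ , trans (cell eq bσ) (splitAt-at σ s12)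
      where bσ = sep-box (mixFits eq)

    benign⇒benignStates : Benign lam mu P → BenignStates C
    benign⇒benignStates benign {k} {k'} k<k' eq eq' between
      with le , strict ← benign k k' _ _ k<k' (mix⇒mixed eq) (mix⇒mixed eq')
                          (λ _ k<m m<k' mixed → between k<m m<k' (isMix-of (proj₂ (proj₂ (mixed⇒mix mixed)))))
                          (mix⇒sep eq) (mix⇒sep eq') =
      le , λ { refl → strict (true⇒hasBoth eq') }

    benignStates⇒benign : BenignStates C → Benign lam mu P
    benignStates⇒benign benign k k' r r' k<k' mixed mixed' between sep sep'
      with σ , b , eq ← mixed⇒mix mixed | σ' , b' , eq' ← mixed⇒mix mixed'
      with refl ← sep-unique {P} sep (mix⇒sep eq) | refl ← sep-unique {P} sep' (mix⇒sep eq')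
      with le , strict ← benign k<k' eq eq' (λ k<m m<k' isMix → between _ k<m m<k' (isMix⇒mixed isMix)) =
      le , λ both → strict (hasBoth⇒true eq' both)

    descentPair⇒descent : ∀ {k a b} → C k ≡ a → C (suc k) ≡ b → DescentPair k a b → Descent lam mu P k
    descentPair⇒descent eq eq' (twos-ones bi bi') =
      _ , bi , bi' , cong maxV (cell eq bi) , cong minV (cell eq' bi')
    descentPair⇒descent eq eq' (twos-mix f) with bs , has1 , _ ← mix⇒last1 eq' =
      _ , lastOne-box f , bs , cong maxV (cell eq (lastOne-box f)) , has1
    descentPair⇒descent eq eq' (mix-ones f) with bσ , has2 , _ ← mix⇒sep eq =
      _ , bσ , sep-box f , has2 , cong minV (cell eq' (sep-box f))

    stateDescent⇒descent : ∀ {k} → StateDescent C k → Descent lam mu P k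
    stateDescent⇒descent = descentPair⇒descent refl refl

    sep≤ : ∀ {i k σ b} → C k ≡ mix σ b → Box i k → Has2 (P i k) → σ ≤ i
    sep≤ eq bi has2 = ≮⇒≥ λ i<σ → proj₂ (proj₂ (mix⇒sep eq)) _ i<σ bi has2

    ≤lastOne : ∀ {i k σ b} → C k ≡ mix σ b → Box i k → Has1 (P i k) → i ≤ lastOne σ b
    ≤lastOne eq bi has1 = ≮⇒≥ λ last<i → proj₂ (proj₂ (mix⇒last1 eq)) _ last<i bi has1

    descent⇒stateDescent : BenignStates C → ∀ {k} → Descent lam mu P k → StateDescent C k
    descent⇒stateDescent benign {k} (i , bi , bi' , has2 , has1) with C k in eq | C (suc k) in eq'
    ... | ones | _    with () ← trans (sym (cong maxV (cell eq bi))) has2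
    ... | _    | twos with () ← trans (sym (cong minV (cell eq' bi'))) has1
    ... | twos    | ones    = twos-ones bi bi'
    ... | twos    | mix _ _ = twos-mix (mixFits-left bi (≤lastOne eq' bi' has1) (mixFits eq'))
    ... | mix _ _ | ones    = mix-ones (mixFits-right (sep≤ eq bi has2) bi' (mixFits eq))
    ... | mix _ _ | mix _ _
      -- Benignity puts the last 1 of column k + 1 strictly above the first 2 of column k.
      with le , strict ← benign (n<1+n k) eq eq' (λ k<m m<1+k → ⊥-elim (<⇒≱ k<m (≤-pred m<1+k))) =
      ⊥-elim (<⇒≱ (lastOne<sep (mixFits eq') le strict) (≤-trans (sep≤ eq bi has2) (≤lastOne eq' bi' has1)))

    agrees-with-exchange : ∀ {F k} → (∀ i → F i k ≡ entry (C (suc k)) i) → (∀ i → F i (suc k) ≡ entry (C k) i) →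
                           (∀ {i j} → j < k ⊎ suc k < j → F i j ≡ P i j) → F ≈ fill (swapAt k C)
    agrees-with-exchange {F} left right apart i j bij =
      swapAt-elim (λ j c → Box i j → F i j ≡ entry c i) {C} (λ _ → left i) (λ _ → right i)
                  (λ j-apart bij → trans (apart j-apart) (P≈C i _ bij)) j bij

    entry-via : ∀ {k c} i → C k ≡ c → entry c i ≡ entry (C k) i
    entry-via i eq = cong (λ c → entry c i) (sym eq)

    resM1≈exchange : ∀ {k σ b} → C k ≡ mix σ b → C (suc k) ≡ ones → resM1 P k σ ≈ fill (swapAt k C)
    resM1≈exchange {k} {σ} {b} eq eq' = agrees-with-exchange
      (λ i → trans (if-≡ᵇ-refl k) (entry-via i eq'))
      (λ i → begin
        resM1 P k σ i (suc k)
          ≡⟨ if-≡ᵇ-≢ (>⇒≢ (n<1+n k)) ⟩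
        (if suc k ≡ᵇ suc k then splitAt σ (P σ k) i else P i (suc k))
          ≡⟨ if-≡ᵇ-refl (suc k) ⟩
        splitAt σ (P σ k) i
          ≡⟨ cong (λ v → splitAt σ v i) (trans (cell eq (sep-box (mixFits eq))) (splitAt-at σ _)) ⟩
        entry (mix σ b) i
          ≡⟨ entry-via i eq ⟩
        entry (C k) i ∎)
      (λ apart → trans (if-≡ᵇ-≢ (proj₁ (apart⇒≢ apart))) (if-≡ᵇ-≢ (proj₂ (apart⇒≢ apart))))
      where open ≡-Reasoning

    res2M≈exchange : ∀ {k σ b} → C k ≡ twos → C (suc k) ≡ mix σ b →
                     res2M P k (lastOne σ b) ≈ fill (swapAt k C)
    res2M≈exchange {k} {σ} {b} eq eq' = agrees-with-exchange
      (λ i → begin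
        res2M P k (lastOne σ b) i k
          ≡⟨ if-≡ᵇ-≢ (<⇒≢ (n<1+n k)) ⟩
        (if k ≡ᵇ k then splitAt (lastOne σ b) (P (lastOne σ b) (suc k)) i else P i k)
          ≡⟨ if-≡ᵇ-refl k ⟩
        splitAt (lastOne σ b) (P (lastOne σ b) (suc k)) i
          ≡⟨ lastOne-split {P} (mixFits eq') (λ _ → cell eq') i ⟩
        entry (mix σ b) i
          ≡⟨ entry-via i eq' ⟩
        entry (C (suc k)) i ∎)
      (λ i → trans (if-≡ᵇ-refl (suc k)) (entry-via i eq))
      (λ apart → trans (if-≡ᵇ-≢ (proj₂ (apart⇒≢ apart))) (if-≡ᵇ-≢ (proj₁ (apart⇒≢ apart))))
      where open ≡-Reasoning

    res21≈exchange : ∀ {k} → C k ≡ twos → C (suc k) ≡ ones → res21 P k ≈ fill (swapAt k C)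
    res21≈exchange {k} eq eq' = agrees-with-exchange
      (λ i → trans (if-≡ᵇ-refl k) (entry-via i eq'))
      (λ i → trans (if-≡ᵇ-≢ (>⇒≢ (n<1+n k))) (trans (if-≡ᵇ-refl (suc k)) (entry-via i eq)))
      (λ apart → trans (if-≡ᵇ-≢ (proj₁ (apart⇒≢ apart))) (if-≡ᵇ-≢ (proj₂ (apart⇒≢ apart))))

    isRes⇒exchange : ∀ {k Q} → IsRes lam mu P k Q → Q ≈ fill (swapAt k C)
    isRes⇒exchange (inj₁ (mixed , onePure , _ , sep , Q≈))
      with _ , _ , eq ← mixed⇒mix mixed
      with refl ← sep-unique {P} sep (mix⇒sep eq) = ≈-trans Q≈ (resM1≈exchange eq (onePure⇒ones onePure))
    isRes⇒exchange (inj₂ (inj₁ (twoPure , mixed , _ , last1 , Q≈)))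
      with _ , _ , eq ← mixed⇒mix mixed
      with refl ← last1-unique {P} last1 (mix⇒last1 eq) = ≈-trans Q≈ (res2M≈exchange (twoPure⇒twos twoPure) eq)
    isRes⇒exchange (inj₂ (inj₂ (twoPure , onePure , Q≈))) =
      ≈-trans Q≈ (res21≈exchange (twoPure⇒twos twoPure) (onePure⇒ones onePure))

    descentPair⇒isRes : ∀ {k a b Q} → C k ≡ a → C (suc k) ≡ b → DescentPair k a b →
                        Q ≈ fill (swapAt k C) → IsRes lam mu P k Q
    descentPair⇒isRes eq eq' (twos-ones bi bi') Q≈ =
      inj₂ (inj₂ (twos⇒twoPure eq (_ , bi) , ones⇒onePure eq' (_ , bi') ,
                  ≈-trans Q≈ (≈-sym (res21≈exchange eq eq'))))
    descentPair⇒isRes eq eq' (twos-mix f) Q≈ =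
      inj₂ (inj₁ (twos⇒twoPure eq (_ , lastOne-box f) , mix⇒mixed eq' , _ , mix⇒last1 eq' ,
                  ≈-trans Q≈ (≈-sym (res2M≈exchange eq eq'))))
    descentPair⇒isRes eq eq' (mix-ones f) Q≈ =
      inj₁ (mix⇒mixed eq , ones⇒onePure eq' (_ , sep-box f) , _ , mix⇒sep eq ,
            ≈-trans Q≈ (≈-sym (resM1≈exchange eq eq')))

    step⇒exchange : BenignStates C → ∀ {Q} → Step lam mu P Q →
                    ∃ λ k → StateDescent C k × Q ≈ fill (swapAt k C)
    step⇒exchange benign (_ , k , descent , res) =
      k , descent⇒stateDescent benign descent , isRes⇒exchange res

    exchange⇒step : BenignStates C → ∀ {k Q} → StateDescent C k → Q ≈ fill (swapAt k C) → Step lam mu P Q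
    exchange⇒step benign d Q≈ =
      benignStates⇒benign benign , _ , stateDescent⇒descent d , descentPair⇒isRes refl refl d Q≈

    normal⇒svrpp : BenignStates C → IsNormalForm _↝_ C → IsSVRPP lam mu P
    normal⇒svrpp benign normal = columns , rows
      where
      columns : Is12SV lam mu P
      columns i k bi bi' =
        subst₂ _≤_ (cong maxV (sym (P≈C i k bi))) (cong minV (sym (P≈C _ k bi'))) (entry-increasing (C k) i)
      rows : ∀ i k → Box i k → Box i (suc k) → maxV (P i k) ≤ minV (P i (suc k))
      rows i k bi bi' with ordered-or-descent (P i k) (P i (suc k))
      ... | inj₁ ordered = ordered
      ... | inj₂ (has2 , has1) =
        ⊥-elim (normal (_ , exchange (descent⇒stateDescent benign (i , bi , bi' , has2 , has1))))

    svrpp⇒normal : IsSVRPP lam mu P → IsNormalForm _↝_ C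
    svrpp⇒normal (_ , rows) (_ , exchange d) with i , bi , bi' , has2 , has1 ← stateDescent⇒descent d =
      ≤⇒≯ (subst₂ _≤_ has2 has1 (rows i _ bi bi')) (n<1+n 1)

  lift : ∀ {P C N} → Good C → P ≈ fill C → C ↝* N → ∃ λ F → Steps lam mu P F × F ≈ fill N
  lift good P≈C ε = _ , ε , P≈C
  lift good@(valid , benign) P≈C (s@(exchange d) ◅ p)
    with F , steps , F≈N ← lift (good-step good s) (λ _ _ _ → refl) p =
    F , Representation.exchange⇒step valid P≈C benign d (λ _ _ _ → refl) ◅ steps , F≈N

  project : ∀ {P C N} → Good C → P ≈ fill C → Steps lam mu P N → ∃ λ D → C ↝* D × N ≈ fill D
  project good P≈C ε = _ , ε , P≈C
  project good@(valid , benign) P≈C (s ◅ steps)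
    with k , d , Q≈ ← Representation.step⇒exchange valid P≈C benign s
    with D , p , N≈D ← project (good-step good (exchange d)) Q≈ steps =
    D , exchange d ◅ p , N≈D

  fill-cong : ∀ {C D} → C ≗ D → fill C ≈ fill D
  fill-cong C≗D i j _ = cong (λ c → entry c i) (C≗D j)

proposition2p10 : (lam mu : List ℕ) → IsPartition lam → IsPartition mu → mu ⊆ₚ lam →
    (T : Filling) → Is12SV lam mu T → Benign lam mu T →
    Σ Filling (λ N → (IsSVRPP lam mu N × Steps lam mu T N) ×
      ((N' : Filling) → IsSVRPP lam mu N' → Steps lam mu T N' → AgreeOn lam mu N' N))
proposition2p10 lam mu lam-partition mu-partition _ T t12 benign =
  let C , valid , T≈C    = represent t12
      good : Good C
      good = valid , Representation.benign⇒benignStates valid T≈C benign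
      N , C↝N , N-normal = normalise C
      F , T↝F , F≈N      = lift good T≈C C↝N
      valid-N , benign-N = good-steps good C↝N
  in F , (Representation.normal⇒svrpp valid-N F≈N benign-N N-normal , T↝F) ,
     λ N' svrpp' T↝N' →
       let D , C↝D , N'≈D = project good T≈C T↝N'
           D-normal       = Representation.svrpp⇒normal (proj₁ (good-steps good C↝D)) N'≈D svrpp'
           D≗N            = normalForm-unique (λ _ → refl) C↝D C↝N D-normal N-normal
       in ≈-trans N'≈D (≈-trans (fill-cong D≗N) (≈-sym F≈N))
  where open Shape lam mu lam-partition mu-partition
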